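{- Let $G=(V,E)$ be a simple graph and $\mathcal{N}(G)$ its neighborhood complex, regarded as a simplicial complex on $V$. If $\kappa\colon V\to[k]$ is a $k$-linear coloring of $\mathcal{N}(G)$, then $\kappa$ is a (proper vertex) coloring of $G$, i.e. $\kappa(x)\neq\kappa(y)$ whenever $(x,y)\in E$.
   Context: $\mathcal{N}(G)$ is the simplicial complex whose simplices are the subsets of $V$ having a common neighbor in $G$. For a simplicial complex with vertex set $V$ and $\kappa\colon V\to[k]=\{1,\dots,k\}$, $S_\kappa(t)=|\{v\in S:\kappa(v)=t\}|$; a $k$-linear coloring is a surjective $\kappa$ with $\sum_t\min(F_\kappa(t),F'_\kappa(t))=|F\cap F'|$ for all facets (maximal faces) $F,F'$. -}

module Defs where

open import Data.Nat using (ℕ; _⊓_)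
open import Data.Fin using (Fin)
open import Data.Fin.Properties using (_≟_)
open import Data.Fin.Subset using (Subset; _∈_; _⊆_; _∩_; ∣_∣)
open import Data.Bool using (Bool; true; false)
open import Data.Empty using (⊥)
open import Data.Vec using (tabulate)
open import Data.List using (map; allFin)
open import Data.Nat.ListAction using (sum)
open import Data.Product using (Σ; _×_; ∃)
open import Relation.Nullary.Decidable using (⌊_⌋)
open import Relation.Binary.PropositionalEquality using (_≡_)
open import Function.Definitions using (Surjective)

record SimpleGraph (n : ℕ) : Set where
  field
    adj   : Fin n → Fin n → Bool
    sym   : ∀ x y → adj x y ≡ adj y x
    irrefl : ∀ x → adj x x ≡ false

open SimpleGraph public

Edge : ∀ {n} → SimpleGraph n → Fin n → Fin n → Set
Edge G x y = adj G x y ≡ true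

NbhdFace : ∀ {n} → SimpleGraph n → Subset n → Set
NbhdFace G S = ∃ λ v → ∀ {u} → u ∈ S → Edge G u v

NbhdFacet : ∀ {n} → SimpleGraph n → Subset n → Set
NbhdFacet G F = NbhdFace G F × (∀ S → NbhdFace G S → F ⊆ S → S ≡ F)

colourClass : ∀ {n k} → (Fin n → Fin k) → Fin k → Subset n
colourClass κ t = tabulate (λ v → ⌊ κ v ≟ t ⌋)

countColour : ∀ {n k} → (Fin n → Fin k) → Subset n → Fin k → ℕ
countColour κ S t = ∣ S ∩ colourClass κ t ∣

IsLinearColoring : ∀ {n} (k : ℕ) → (Subset n → Set) → (Fin n → Fin k) → Set
IsLinearColoring {n} k Facet κ =
  Surjective _≡_ _≡_ κ ×
  (∀ F F′ → Facet F → Facet F′ →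
     sum (map (λ t → countColour κ F t ⊓ countColour κ F′ t) (allFin k))
       ≡ ∣ F ∩ F′ ∣)

IsProperColoring : ∀ {n k} → SimpleGraph n → (Fin n → Fin k) → Set
IsProperColoring G κ = ∀ x y → Edge G x y → κ x ≡ κ y → ⊥

-- For an edge xy, take a neighbourhood N(w) of maximum size among those containing N(y): it is
-- a facet F of 𝒩(G) with x ∈ F and y ∉ F (if y ∈ N(w) then w ∈ N(y) ⊆ N(w), a loop).
-- Symmetrically there is a facet F′ with y ∈ F′ and x ∉ F′. Colour by colour,
-- (F ∩ F′)_κ(t) ≤ min(F_κ(t), F′_κ(t)); summing over t gives |F ∩ F′| on the left and,
-- by linearity, |F ∩ F′| on the right, so every inequality is an equality. But if
-- κ(x) = κ(y) = c, then x witnesses (F ∩ F′)_κ(c) < F_κ(c) and y witnesses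
-- (F ∩ F′)_κ(c) < F′_κ(c).
module Submission where

open import Data.Bool using (Bool; true; false)
open import Data.Fin using (Fin; zero; suc)
open import Data.Fin.Properties using (_≟_; suc-injective)
open import Data.Fin.Subset using (Subset; _∈_; _∉_; _⊆_; _∩_; ∣_∣; inside; outside)
open import Data.Fin.Subset.Properties
  using (_∈?_; _⊆?_; ⊆-refl; ⊆-trans; ⊆-antisym; p∩q⊆p; p∩q⊆q; x∈p∩q⁺; x∈p∩q⁻;
         p⊆q⇒∣p∣≤∣q∣; p⊂q⇒∣p∣<∣q∣)
open import Data.List using (List; map; allFin; filter)
import Data.List as List
open import Data.List.Extrema.Nat using (argmax; argmax-all; f[xs]≤f[argmax])
open import Data.List.Membership.Propositional.Properties using (∈-allFin; ∈-filter⁺)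
open import Data.List.Properties using (map-tabulate)
import Data.List.Relation.Unary.All as All
open import Data.List.Relation.Unary.All.Properties using (all-filter)
open import Data.Nat using (ℕ; zero; suc; _+_; _⊓_; _≤_; _<_; z≤n)
open import Data.Nat.ListAction using (sum)
open import Data.Nat.Properties
  using (+-0-commutativeMonoid; +-suc; +-mono-≤; +-mono-<-≤; +-mono-≤-<; ⊓-glb; ⊓-pres-m<; <⇒≢; <⇒≱)
open import Data.Product using (_×_; _,_; proj₁; proj₂; ∃-syntax)
open import Data.Vec using ([]; _∷_; tabulate)
open import Data.Vec.Properties using (lookup∘tabulate; lookup⇒[]=; []=⇒lookup)
open import Function using (_∘_)
open import Relation.Binary.PropositionalEquality using (_≡_; _≢_; refl; sym; trans; cong; cong₂; module ≡-Reasoning)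
open import Relation.Nullary using (Dec; ¬_; yes; no; contradiction)
open import Relation.Nullary.Decidable using (⌊_⌋; dec-true; dec-false; isYes≗does)
open import Relation.Unary using (Pred; Decidable)

open import Defs hiding (sym)
open import Algebra.Properties.CommutativeMonoid.Sum +-0-commutativeMonoid
  using (sum-syntax; sum-cong-≗; sum-replicate-zero)


⌊⌋-true : ∀ {a} {A : Set a} (a? : Dec A) → A → ⌊ a? ⌋ ≡ true
⌊⌋-true a? a = trans (isYes≗does a?) (dec-true a? a)

⌊⌋-false : ∀ {a} {A : Set a} (a? : Dec A) → ¬ A → ⌊ a? ⌋ ≡ false
⌊⌋-false a? ¬a = trans (isYes≗does a?) (dec-false a? ¬a)

∃-argmax : ∀ {n p} {P : Pred (Fin n) p} → Decidable P → (f : Fin n → ℕ) → ∀ {w₀} → P w₀ →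
           ∃[ w ] P w × (∀ v → P v → f v ≤ f w)
∃-argmax {n} P? f {w₀} Pw₀ =
  argmax f w₀ candidates ,
  argmax-all f Pw₀ (all-filter P? (allFin n)) ,
  λ v Pv → All.lookup (f[xs]≤f[argmax] w₀ candidates) (∈-filter⁺ P? (∈-allFin v) Pv)
  where
  candidates : List (Fin n)
  candidates = filter P? (allFin n)

sum-allFin : ∀ {k} (f : Fin k → ℕ) → sum (map f (allFin k)) ≡ ∑[ t < k ] f t
sum-allFin f = trans (cong sum (map-tabulate (λ t → t) f)) (sum-tabulate f)
  where
  sum-tabulate : ∀ {k} (f : Fin k → ℕ) → sum (List.tabulate f) ≡ ∑[ t < k ] f t
  sum-tabulate {zero}  f = refl
  sum-tabulate {suc k} f = cong (f zero +_) (sum-tabulate (f ∘ suc))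

∑-mono-≤ : ∀ {k} {f g : Fin k → ℕ} → (∀ t → f t ≤ g t) → ∑[ t < k ] f t ≤ ∑[ t < k ] g t
∑-mono-≤ {zero}  f≤g = z≤n
∑-mono-≤ {suc k} f≤g = +-mono-≤ (f≤g zero) (∑-mono-≤ (f≤g ∘ suc))

∑-mono-< : ∀ {k} {f g : Fin k → ℕ} (c : Fin k) → (∀ t → f t ≤ g t) → f c < g c →
           ∑[ t < k ] f t < ∑[ t < k ] g t
∑-mono-< zero    f≤g fc<gc = +-mono-<-≤ fc<gc (∑-mono-≤ (f≤g ∘ suc))
∑-mono-< (suc c) f≤g fc<gc = +-mono-≤-< (f≤g zero) (∑-mono-< c (f≤g ∘ suc) fc<gc)

∑-suc-at : ∀ {k} {f g : Fin k → ℕ} (c : Fin k) → f c ≡ suc (g c) → (∀ t → c ≢ t → f t ≡ g t) →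
           ∑[ t < k ] f t ≡ suc (∑[ t < k ] g t)
∑-suc-at zero    fc≡1+gc f≡g = cong₂ _+_ fc≡1+gc (sum-cong-≗ (λ t → f≡g (suc t) λ ()))
∑-suc-at (suc c) fc≡1+gc f≡g =
  trans (cong₂ _+_ (f≡g zero λ ()) (∑-suc-at c fc≡1+gc (λ t c≢t → f≡g (suc t) (c≢t ∘ suc-injective))))
        (+-suc _ _)

p⊆q∧∣q∣≤∣p∣⇒q⊆p : ∀ {n} {p q : Subset n} → p ⊆ q → ∣ q ∣ ≤ ∣ p ∣ → q ⊆ p
p⊆q∧∣q∣≤∣p∣⇒q⊆p {p = p} p⊆q ∣q∣≤∣p∣ {x} x∈q with x ∈? p
... | yes x∈p = x∈p
... | no  x∉p = contradiction ∣q∣≤∣p∣ (<⇒≱ (p⊂q⇒∣p∣<∣q∣ (p⊆q , x , x∈q , x∉p)))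

∩-monoˡ-⊆ : ∀ {n} {p q : Subset n} (r : Subset n) → p ⊆ q → p ∩ r ⊆ q ∩ r
∩-monoˡ-⊆ {p = p} r p⊆q x∈p∩r with x∈p∩q⁻ p r x∈p∩r
... | x∈p , x∈r = x∈p∩q⁺ (p⊆q x∈p , x∈r)

∈-tabulate⁺ : ∀ {n} {f : Fin n → Bool} {x} → f x ≡ true → x ∈ tabulate f
∈-tabulate⁺ {f = f} {x} fx≡true = lookup⇒[]= x (tabulate f) (trans (lookup∘tabulate f x) fx≡true)

∈-tabulate⁻ : ∀ {n} {f : Fin n → Bool} {x} → x ∈ tabulate f → f x ≡ true
∈-tabulate⁻ {f = f} {x} x∈ = trans (sym (lookup∘tabulate f x)) ([]=⇒lookup x∈)

module _ {n k} (κ : Fin n → Fin k) where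

  ∈-colourClass : ∀ {x t} → κ x ≡ t → x ∈ colourClass κ t
  ∈-colourClass {x} {t} κx≡t = ∈-tabulate⁺ (⌊⌋-true (κ x ≟ t) κx≡t)

  countColour-mono : ∀ {S S′} t → S ⊆ S′ → countColour κ S t ≤ countColour κ S′ t
  countColour-mono t S⊆S′ = p⊆q⇒∣p∣≤∣q∣ (∩-monoˡ-⊆ (colourClass κ t) S⊆S′)

  countColour-strictMono : ∀ {S S′ x t} → S ⊆ S′ → x ∈ S′ → x ∉ S → κ x ≡ t →
                           countColour κ S t < countColour κ S′ t
  countColour-strictMono {S} {t = t} S⊆S′ x∈S′ x∉S κx≡t = p⊂q⇒∣p∣<∣q∣
    ( ∩-monoˡ-⊆ (colourClass κ t) S⊆S′
    , _ , x∈p∩q⁺ (x∈S′ , ∈-colourClass κx≡t) , x∉S ∘ proj₁ ∘ x∈p∩q⁻ S (colourClass κ t))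

∑-countColour : ∀ {n k} (κ : Fin n → Fin k) (S : Subset n) → ∑[ t < k ] countColour κ S t ≡ ∣ S ∣
∑-countColour {k = k} κ []            = sum-replicate-zero k
∑-countColour         κ (outside ∷ S) = ∑-countColour (κ ∘ suc) S
∑-countColour         κ (inside ∷ S)  =
  trans (∑-suc-at (κ zero) (countColour-∷ (⌊⌋-true (κ zero ≟ κ zero) refl))
                           (λ t κ₀≢t → countColour-∷ (⌊⌋-false (κ zero ≟ t) κ₀≢t)))
        (cong suc (∑-countColour (κ ∘ suc) S))
  where
  countColour-∷ : ∀ {t b} → ⌊ κ zero ≟ t ⌋ ≡ b →
                  countColour κ (inside ∷ S) t ≡ ∣ b ∷ S ∩ colourClass (κ ∘ suc) t ∣
  countColour-∷ {t} = cong (λ b → ∣ b ∷ S ∩ colourClass (κ ∘ suc) t ∣)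

module _ {n} (G : SimpleGraph n) where

  Nbhd : Fin n → Subset n
  Nbhd w = tabulate (λ u → adj G u w)

  Edge⇒∈Nbhd : ∀ {u w} → Edge G u w → u ∈ Nbhd w
  Edge⇒∈Nbhd = ∈-tabulate⁺

  ∈Nbhd⇒Edge : ∀ {u w} → u ∈ Nbhd w → Edge G u w
  ∈Nbhd⇒Edge = ∈-tabulate⁻

  Edge-sym : ∀ {x y} → Edge G x y → Edge G y x
  Edge-sym {x} {y} x~y = trans (SimpleGraph.sym G y x) x~y

  Edge-irrefl : ∀ {x} → ¬ Edge G x x
  Edge-irrefl {x} x~x with trans (sym (irrefl G x)) x~x
  ... | ()

  Nbhd-⊆⇒∉ : ∀ {y w} → Nbhd y ⊆ Nbhd w → y ∉ Nbhd w
  Nbhd-⊆⇒∉ Ny⊆Nw y∈Nw = Edge-irrefl (∈Nbhd⇒Edge (Ny⊆Nw (Edge⇒∈Nbhd (Edge-sym (∈Nbhd⇒Edge y∈Nw)))))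

  maximalNbhd⇒facet : ∀ {w} → (∀ v → Nbhd w ⊆ Nbhd v → ∣ Nbhd v ∣ ≤ ∣ Nbhd w ∣) →
                      NbhdFacet G (Nbhd w)
  maximalNbhd⇒facet {w} maximal = (w , ∈Nbhd⇒Edge) , λ S (v , S~v) Nw⊆S →
    let S⊆Nv : S ⊆ Nbhd v
        S⊆Nv u∈S = Edge⇒∈Nbhd (S~v u∈S)
        Nw⊆Nv = ⊆-trans Nw⊆S S⊆Nv
        Nv⊆Nw = p⊆q∧∣q∣≤∣p∣⇒q⊆p Nw⊆Nv (maximal v Nw⊆Nv)
    in ⊆-antisym (⊆-trans S⊆Nv Nv⊆Nw) Nw⊆S

  separatingFacet : ∀ {x y} → Edge G x y → ∃[ F ] NbhdFacet G F × x ∈ F × y ∉ F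
  separatingFacet {x} {y} x~y with ∃-argmax (λ w → Nbhd y ⊆? Nbhd w) (λ w → ∣ Nbhd w ∣) ⊆-refl
  ... | w , Ny⊆Nw , largest =
    Nbhd w ,
    maximalNbhd⇒facet (λ v Nw⊆Nv → largest v (⊆-trans Ny⊆Nw Nw⊆Nv)) ,
    Ny⊆Nw (Edge⇒∈Nbhd x~y) ,
    Nbhd-⊆⇒∉ Ny⊆Nw

proposition8p1 : ∀ {n k} (G : SimpleGraph n) (κ : Fin n → Fin k) →
    IsLinearColoring k (NbhdFacet G) κ → IsProperColoring G κ
proposition8p1 {k = k} G κ (_ , linear) x y x~y κx≡κy
  with separatingFacet G x~y | separatingFacet G (Edge-sym G x~y)
... | F , F-facet , x∈F , y∉F | F′ , F′-facet , y∈F′ , x∉F′ =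
  <⇒≢ (∑-mono-< (κ x) common≤min common<min) (begin
    ∑[ t < k ] countColour κ (F ∩ F′) t  ≡⟨ ∑-countColour κ (F ∩ F′) ⟩
    ∣ F ∩ F′ ∣                            ≡⟨ linear F F′ F-facet F′-facet ⟨
    sum (map minCount (allFin k))         ≡⟨ sum-allFin minCount ⟩
    ∑[ t < k ] minCount t                 ∎)
  where
  open ≡-Reasoning
  minCount : Fin k → ℕ
  minCount t = countColour κ F t ⊓ countColour κ F′ t

  common≤min : ∀ t → countColour κ (F ∩ F′) t ≤ minCount t
  common≤min t = ⊓-glb (countColour-mono κ t (p∩q⊆p F F′)) (countColour-mono κ t (p∩q⊆q F F′))

  common<min : countColour κ (F ∩ F′) (κ x) < minCount (κ x)
  common<min = ⊓-pres-m<
    (countColour-strictMono κ (p∩q⊆p F F′) x∈F  (x∉F′ ∘ proj₂ ∘ x∈p∩q⁻ F F′) refl)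
    (countColour-strictMono κ (p∩q⊆q F F′) y∈F′ (y∉F ∘ proj₁ ∘ x∈p∩q⁻ F F′) (sym κx≡κy))
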